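{- Let $q\ge 19$ be an odd prime and let $H$ be an integer with $\lfloor (q-1)/3\rfloor\le H\le (q-1)/2$. Let $\mathcal{C}$ be the conic $x_1^2=x_0x_2$, $\mathcal{V}_H=\{(1,i,i^2): i=0,1,\dots,H\}\subset\mathcal{C}$, $P=(0,1,0)$, $T_H=(0,1,b_H)$ where $b_H=2H+1$ if $H=\lfloor (q-1)/3\rfloor$ and $b_H=2H$ otherwise, $\mathcal{K}_H=\mathcal{V}_H\cup\{P,T_H\}$, and let $\ell_0$ be the line $x_0=0$. Then every point of $\ell_0\cup(\mathcal{C}\setminus\mathcal{V}_H)$ lies on a bisecant of $\mathcal{K}_H$.
   Context: Points of $PG(2,q)$ are in homogeneous coordinates $(x_0,x_1,x_2)$; integers are read in $F_q$. A bisecant of a point set $\mathcal{K}$ is a line through two distinct points of $\mathcal{K}$. -}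

module Defs where

open import Data.Nat as ℕ using (ℕ; _≤_; _≟_)
open import Data.Nat.DivMod using (_/_)
open import Data.Integer as ℤ using (ℤ; +_; _-_; _*_; _+_)
open import Data.Integer.Divisibility using (_∣_)
open import Data.Product using (_×_; _,_; Σ; ∃)
open import Data.Sum using (_⊎_)
open import Relation.Nullary using (¬_; yes; no)
open import Relation.Binary.PropositionalEquality using (_≡_)

-- Triples of integers; coordinates are read in F_q (i.e. modulo q).
Triple : Set
Triple = ℤ × ℤ × ℤ

IsZero : ℕ → ℤ → Set
IsZero q z = (+ q) ∣ z

IsPoint : ℕ → Triple → Set
IsPoint q (x , y , z) = ¬ (IsZero q x × IsZero q y × IsZero q z)

SamePoint : ℕ → Triple → Triple → Set
SamePoint q (a0 , a1 , a2) (b0 , b1 , b2) =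
  IsZero q (a1 * b2 - a2 * b1) × IsZero q (a2 * b0 - a0 * b2) × IsZero q (a0 * b1 - a1 * b0)

det3 : Triple → Triple → Triple → ℤ
det3 (a0 , a1 , a2) (b0 , b1 , b2) (c0 , c1 , c2) =
  a0 * (b1 * c2 - b2 * c1) - a1 * (b0 * c2 - b2 * c0) + a2 * (b0 * c1 - b1 * c0)

Collinear : ℕ → Triple → Triple → Triple → Set
Collinear q a b c = IsZero q (det3 a b c)

OnConic : ℕ → Triple → Set
OnConic q (x0 , x1 , x2) = IsZero q (x1 * x1 - x0 * x2)

OnL0 : ℕ → Triple → Set
OnL0 q (x0 , x1 , x2) = IsZero q x0

vpt : ℕ → Triple
vpt i = (+ 1 , + i , + (i ℕ.* i))

InV : ℕ → ℕ → Triple → Set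
InV q H X = Σ ℕ λ i → i ≤ H × SamePoint q X (vpt i)

Ppt : Triple
Ppt = (+ 0 , + 1 , + 0)

bH : ℕ → ℕ → ℕ
bH q H with H ≟ (q ℕ.∸ 1) / 3
... | yes _ = 2 ℕ.* H ℕ.+ 1
... | no _  = 2 ℕ.* H

Tpt : ℕ → ℕ → Triple
Tpt q H = (+ 0 , + 1 , + bH q H)

-- the chosen representatives of the points of K_H = V_H ∪ {P, T_H}
InK : ℕ → ℕ → Triple → Set
InK q H A = (A ≡ Ppt) ⊎ (A ≡ Tpt q H) ⊎ (Σ ℕ λ i → i ≤ H × A ≡ vpt i)

OnBisecant : ℕ → ℕ → Triple → Set
OnBisecant q H X =
  Σ Triple λ A → Σ Triple λ B →
    InK q H A × InK q H B × ¬ SamePoint q A B × Collinear q X A B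

module Submission where

-- Write q for the prime, b = b_H, T = (0,1,b) and P = (0,1,0).
--
-- A point X of ℓ₀ lies on the bisecant PT, which is ℓ₀ itself; P ≠ T since
-- 0 < b < q.  Any other point X of the conic has x₀ invertible mod q, so
-- X = (1,t,t²) for a residue 0 ≤ t < q, and X ∉ V_H forces t > H.
--   * If q ≤ t + H, then i = q - t ≤ H, and the bisecant through P and
--     (1,i,i²) is the line x₂ = i²x₀, which contains (1,-i,i²) = (1,t,t²).
--   * If t + H < q, then t ≤ b and i = b - t ≤ H, and the bisecant through
--     T and (1,i,i²) contains (1,i,i²) + (t - i)(0,1,i + t) = (1,t,t²).
-- The only properties of b_H used are 0 < b < q ≤ b + H + 1 and b ≤ 2H + 1
-- (the record 'Bounds'); proving them is where 3 ∤ q enters.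

open import Defs
open import Data.Nat using (ℕ; _≤_; _%_)
open import Data.Nat.DivMod using (_/_)
open import Data.Nat.Primality using (Prime)
open import Data.Sum using (_⊎_)
open import Data.Product using (_×_)
open import Relation.Nullary using (¬_)
open import Relation.Binary.PropositionalEquality using (_≡_)

open import Data.Nat as ℕ using (zero; suc; _<_; _∸_; _≤?_; s≤s; z≤n; NonZero; nonTrivial⇒n>1)
import Data.Nat.Properties as ℕₚ
import Data.Nat.Divisibility as ℕ∣
open import Data.Nat.DivMod using (m≡m%n+[m/n]*n; m%n<n; /-monoˡ-≤; m/n*n≤m)
open import Data.Nat.Primality using (prime⇒irreducible; prime⇒nonZero; prime⇒nonTrivial)
open import Data.Nat.Coprimality using (Coprime; coprime-Bézout)
open import Data.Nat.GCD using (module Bézout)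
import Data.Nat.Tactic.RingSolver as ℕ-Ring
open import Data.Integer using (ℤ; +_; -[1+_]; _+_; _*_; _-_; -_; ∣_∣)
import Data.Integer.Properties as ℤₚ
open import Data.Integer.Divisibility.Signed using (_∣_; divides; ∣-refl; ∣ᵤ⇒∣; ∣⇒∣ᵤ; ∣m∣n⇒∣m+n; ∣n⇒∣m*n; ∣m⇒∣m*n)
open import Data.Integer.DivMod using (_%ℕ_; _/ℕ_; n%ℕd<d; a≡a%ℕn+[a/ℕn]*n)
open import Data.Integer.Tactic.RingSolver using (solve-∀)
open import Data.Product using (_,_; ∃)
open import Data.Sum using (inj₁; inj₂)
open import Data.Empty using (⊥-elim)
open import Relation.Nullary using (Dec; yes; no)
open import Relation.Binary.PropositionalEquality using (_≢_; refl; sym; trans; cong; subst; module ≡-Reasoning)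

-- Congruences are expressed as signed divisibility 'Q ∣ e' (e ≡ 0 mod Q); each
-- one below is obtained from hypotheses of this form by a ring identity and
-- an integer combination.
∣-by : ∀ {k m n} → m ≡ n → k ∣ n → k ∣ m
∣-by refl k∣n = k∣n

IsZero⇒∣ : ∀ q z → IsZero q z → + q ∣ z
IsZero⇒∣ q z = ∣ᵤ⇒∣ {+ q} {z}

∣-combination : ∀ {k m n} → k ∣ m → k ∣ n → ∀ a b → k ∣ a * m + b * n
∣-combination k∣m k∣n a b = ∣m∣n⇒∣m+n (∣n⇒∣m*n a k∣m) (∣n⇒∣m*n b k∣n)

cancel-unit : ∀ {Q u x y} → Q ∣ u * x - + 1 → Q ∣ x * y → Q ∣ y
cancel-unit {u = u} {x} {y} ux≡1 xy≡0 =
  ∣-by (identity u x y) (∣-combination ux≡1 xy≡0 (- y) u)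
  where
  identity : ∀ u x y → y ≡ (- y) * (u * x - + 1) + u * (x * y)
  identity = solve-∀

residue-congruent : ∀ q .{{_ : NonZero q}} s → + q ∣ s - + (s %ℕ q)
residue-congruent q s = divides (s /ℕ q)
  (trans (cong (_- r) (a≡a%ℕn+[a/ℕn]*n s q)) (cancel r (s /ℕ q * + q)))
  where
  r = + (s %ℕ q)
  cancel : ∀ r m → r + m - r ≡ m
  cancel = solve-∀

prime>1 : ∀ {q} → Prime q → 1 < q
prime>1 {q} q-prime = nonTrivial⇒n>1 q {{prime⇒nonTrivial q-prime}}

prime-coprime : ∀ {q n} → Prime q → ¬ (q ℕ∣.∣ n) → Coprime q n
prime-coprime q-prime q∤n {d} (d∣q , d∣n) with prime⇒irreducible q-prime d∣q
... | inj₁ d≡1 = d≡1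
... | inj₂ refl = ⊥-elim (q∤n d∣n)

to-ℤ : ∀ a b c d → 1 ℕ.+ a ℕ.* b ≡ c ℕ.* d → + 1 + + a * + b ≡ + c * + d
to-ℤ a b c d eq = begin
  + 1 + + a * + b     ≡⟨ cong (_+_ (+ 1)) (sym (ℤₚ.pos-* a b)) ⟩
  + (1 ℕ.+ a ℕ.* b)   ≡⟨ cong +_ eq ⟩
  + (c ℕ.* d)         ≡⟨ ℤₚ.pos-* c d ⟩
  + c * + d           ∎
  where open ≡-Reasoning

inverse-modℕ : ∀ {q n} → Prime q → ¬ (q ℕ∣.∣ n) → ∃ λ u → + q ∣ u * + n - + 1
inverse-modℕ {q} {n} q-prime q∤n with coprime-Bézout (prime-coprime q-prime q∤n)
... | Bézout.+- x y 1+yn≡xq =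
  - (+ y) , divides (- (+ x)) (negated (+ y) (+ n) (+ x) (+ q) (to-ℤ y n x q 1+yn≡xq))
  where
  negated : ∀ y n x q → + 1 + y * n ≡ x * q → (- y) * n - + 1 ≡ (- x) * q
  negated y n x q eq = trans (lhs y n) (trans (cong -_ eq) (ℤₚ.neg-distribˡ-* x q))
    where
    lhs : ∀ y n → (- y) * n - + 1 ≡ - (+ 1 + y * n)
    lhs = solve-∀
... | Bézout.-+ x y 1+xq≡yn =
  + y , divides (+ x) (trans (cong (_- + 1) (sym (to-ℤ x q y n 1+xq≡yn))) (cancel (+ x * + q)))
  where
  cancel : ∀ m → + 1 + m - + 1 ≡ m
  cancel = solve-∀

inverse-mod : ∀ {q} x → Prime q → ¬ IsZero q x → ∃ λ u → + q ∣ u * x - + 1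
inverse-mod (+ n) q-prime q∤x = inverse-modℕ q-prime q∤x
inverse-mod -[1+ m ] q-prime q∤x with inverse-modℕ q-prime q∤x
... | u , q∣un-1 = - u , ∣-by (negate-both u (+ suc m)) q∣un-1
  where
  negate-both : ∀ u n → (- u) * (- n) - + 1 ≡ u * n - + 1
  negate-both = solve-∀

ConicPointAt : ℤ → Triple → ℤ → Set
ConicPointAt Q (x0 , x1 , x2) T = (Q ∣ x1 - T * x0) × (Q ∣ x2 - T * T * x0)

-- Affine points of the conic: if q is prime and q ∤ x₀, a point of
-- x₁² = x₀x₂ is x₀·(1,t,t²) for the residue t < q of x₁/x₀.
conic-normal-form : ∀ {q} X → Prime q → ¬ OnL0 q X → OnConic q X →
  ∃ λ t → t < q × ConicPointAt (+ q) X (+ t)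
conic-normal-form {q} (x0 , x1 , x2) q-prime q∤x0 onC with inverse-mod x0 q-prime q∤x0
... | u , ux0≡1 = t , n%ℕd<d (x1 * u) q , x1≡tx0 , x2≡t²x0
  where
  instance _ = prime⇒nonZero q-prime
  t = (x1 * u) %ℕ q
  T = + t
  x1≡tx0 : + q ∣ x1 - T * x0
  x1≡tx0 = ∣-by (identity x0 x1 u T)
    (∣-combination ux0≡1 (residue-congruent q (x1 * u)) (- x1) x0)
    where
    identity : ∀ x0 x1 u T → x1 - T * x0 ≡ (- x1) * (u * x0 - + 1) + x0 * (x1 * u - T)
    identity = solve-∀
  -- x₀(x₂ - T²x₀) = -(x₁² - x₀x₂) + (x₁ + Tx₀)(x₁ - Tx₀), and x₀ is a unit
  x2≡t²x0 : + q ∣ x2 - T * T * x0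
  x2≡t²x0 = cancel-unit {u = u} {x = x0} ux0≡1 (∣-by (identity x0 x1 x2 T)
    (∣-combination (IsZero⇒∣ q (x1 * x1 - x0 * x2) onC) x1≡tx0 (- (+ 1)) (x1 + T * x0)))
    where
    identity : ∀ x0 x1 x2 T →
      x0 * (x2 - T * T * x0) ≡ (- (+ 1)) * (x1 * x1 - x0 * x2) + (x1 + T * x0) * (x1 - T * x0)
    identity = solve-∀

vpt-ℤ : ∀ i → vpt i ≡ (+ 1 , + i , + i * + i)
vpt-ℤ i = cong (λ z → (+ 1 , + i , z)) (ℤₚ.pos-* i i)

same-as-vpt : ∀ q X t → ConicPointAt (+ q) X (+ t) → SamePoint q X (vpt t)
same-as-vpt q (x0 , x1 , x2) t (x1≡tx0 , x2≡t²x0) =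
  subst (SamePoint q (x0 , x1 , x2)) (sym (vpt-ℤ t))
    ( ∣⇒∣ᵤ (∣-by (cross₀ x0 x1 x2 T) (∣-combination x1≡tx0 x2≡t²x0 (T * T) (- T)))
    , ∣⇒∣ᵤ (∣-by (cross₁ x0 x1 x2 T) (∣-combination x2≡t²x0 x1≡tx0 (+ 1) (+ 0)))
    , ∣⇒∣ᵤ (∣-by (cross₂ x0 x1 x2 T) (∣-combination x1≡tx0 x2≡t²x0 (- (+ 1)) (+ 0))) )
  where
  T = + t
  cross₀ : ∀ x0 x1 x2 T → x1 * (T * T) - x2 * T ≡ (T * T) * (x1 - T * x0) + (- T) * (x2 - T * T * x0)
  cross₀ = solve-∀
  cross₁ : ∀ x0 x1 x2 T → x2 * + 1 - x0 * (T * T) ≡ (+ 1) * (x2 - T * T * x0) + (+ 0) * (x1 - T * x0)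
  cross₁ = solve-∀
  cross₂ : ∀ x0 x1 x2 T → x0 * T - x1 * + 1 ≡ (- (+ 1)) * (x1 - T * x0) + (+ 0) * (x2 - T * T * x0)
  cross₂ = solve-∀

OnL0? : ∀ q X → Dec (OnL0 q X)
OnL0? q (x0 , _ , _) = q ℕ∣.∣? ∣ x0 ∣

ℓ₀-collinear : ∀ q X B → OnL0 q X → Collinear q X Ppt (+ 0 , + 1 , B)
ℓ₀-collinear q (x0 , x1 , x2) B q∣x0 =
  ∣⇒∣ᵤ (∣-by (determinant x0 x1 x2 B) (∣m⇒∣m*n B (IsZero⇒∣ q x0 q∣x0)))
  where
  determinant : ∀ x0 x1 x2 B →
    x0 * (+ 1 * B - + 0 * + 1) - x1 * (+ 0 * B - + 0 * + 0) + x2 * (+ 0 * + 1 - + 1 * + 0) ≡ x0 * B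
  determinant = solve-∀

-- The line through P and (1,i,i²) is x₂ = i²x₀; it contains x₀·(1,t,t²)
-- whenever t ≡ -i.
P-chord : ∀ q X i t → ConicPointAt (+ q) X (+ t) → + q ∣ + i + + t → Collinear q X Ppt (vpt i)
P-chord q (x0 , x1 , x2) i t (_ , x2≡t²x0) q∣i+t =
  subst (Collinear q (x0 , x1 , x2) Ppt) (sym (vpt-ℤ i))
    (∣⇒∣ᵤ (∣-by (determinant x0 x1 x2 (+ i) (+ t))
      (∣-combination x2≡t²x0 q∣i+t (- (+ 1)) (x0 * (+ i - + t)))))
  where
  determinant : ∀ x0 x1 x2 I T →
    x0 * (+ 1 * (I * I) - + 0 * I) - x1 * (+ 0 * (I * I) - + 0 * + 1) + x2 * (+ 0 * I - + 1 * + 1)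
    ≡ (- (+ 1)) * (x2 - T * T * x0) + (x0 * (I - T)) * (I + T)
  determinant = solve-∀

T-chord : ∀ q X i t → ConicPointAt (+ q) X (+ t) → Collinear q X (+ 0 , + 1 , + (i ℕ.+ t)) (vpt i)
T-chord q (x0 , x1 , x2) i t (x1≡tx0 , x2≡t²x0) =
  subst₂ (sym (ℤₚ.pos-+ i t)) (sym (vpt-ℤ i))
    (∣⇒∣ᵤ (∣-by (determinant x0 x1 x2 (+ i) (+ t))
      (∣-combination x1≡tx0 x2≡t²x0 (+ i + + t) (- (+ 1)))))
  where
  subst₂ : ∀ {B B′ V V′} → B ≡ B′ → V ≡ V′ →
    Collinear q (x0 , x1 , x2) (+ 0 , + 1 , B) V → Collinear q (x0 , x1 , x2) (+ 0 , + 1 , B′) V′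
  subst₂ refl refl c = c
  determinant : ∀ x0 x1 x2 I T →
    x0 * (+ 1 * (I * I) - (I + T) * I) - x1 * (+ 0 * (I * I) - (I + T) * + 1) + x2 * (+ 0 * I - + 1 * + 1)
    ≡ (I + T) * (x1 - T * x0) + (- (+ 1)) * (x2 - T * T * x0)
  determinant = solve-∀

-- No point (0,1,B) of ℓ₀ is a point (1,i,i²) of the conic: their last
-- cross-product coordinate is -1.
ℓ₀-avoids-vpt : ∀ q B i → 1 < q → ¬ SamePoint q (+ 0 , + 1 , B) (vpt i)
ℓ₀-avoids-vpt q B i 1<q (_ , _ , q∣-1) =
  ℕₚ.<⇒≢ 1<q (sym (ℕ∣.∣1⇒≡1 q∣1))
  where
  last-coordinate : ∀ I → + 0 * I - + 1 * + 1 ≡ - (+ 1)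
  last-coordinate = solve-∀
  q∣1 : q ℕ∣.∣ 1
  q∣1 = ∣⇒∣ᵤ (∣-by (sym (last-coordinate (+ i))) (IsZero⇒∣ q _ q∣-1))

P≢T : ∀ q b → 0 < b → b < q → ¬ SamePoint q Ppt (+ 0 , + 1 , + b)
P≢T q b 0<b b<q (q∣b , _ , _) =
  ℕₚ.<⇒≱ b<q (ℕ∣.∣⇒≤ {{ℕ.>-nonZero 0<b}} q∣b′)
  where
  first-coordinate : ∀ B → + 1 * B - + 0 * + 1 ≡ B
  first-coordinate = solve-∀
  q∣b′ : q ℕ∣.∣ b
  q∣b′ = ∣⇒∣ᵤ (∣-by (sym (first-coordinate (+ b))) (IsZero⇒∣ q _ q∣b))

record Bounds (q H b : ℕ) : Set where
  field
    positive : 1 ≤ b              -- T ≠ P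
    below-q  : b < q              -- T ≠ P
    covers   : q ≤ suc (b ℕ.+ H)  -- t + H < q implies t ≤ b
    at-most  : b ≤ suc (H ℕ.+ H)  -- H < t implies b - t ≤ H

prime-mod-3 : ∀ p → Prime (suc p) → 3 < suc p → p % 3 ≢ 2
prime-mod-3 p q-prime 3<q p%3≡2 with prime⇒irreducible q-prime (ℕ∣.divides (suc (p / 3)) q≡3k)
  where
  q≡3k : suc p ≡ suc (p / 3) ℕ.* 3
  q≡3k = cong suc (trans (m≡m%n+[m/n]*n p 3) (cong (ℕ._+ (p / 3 ℕ.* 3)) p%3≡2))
... | inj₁ ()
... | inj₂ 3≡q = ℕₚ.<⇒≢ 3<q 3≡q

bounds-at-third : ∀ p → p % 3 ≢ 2 → 3 ≤ p → Bounds (suc p) (p / 3) (2 ℕ.* (p / 3) ℕ.+ 1)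
bounds-at-third p p%3≢2 3≤p = record
  { positive = ℕₚ.m≤n+m 1 (2 ℕ.* d)
  ; below-q  = s≤s (begin
      2 ℕ.* d ℕ.+ 1  ≤⟨ ℕₚ.+-monoʳ-≤ (2 ℕ.* d) 1≤d ⟩
      2 ℕ.* d ℕ.+ d  ≡⟨ three-d d ⟩
      d ℕ.* 3        ≤⟨ ℕₚ.m≤n+m (d ℕ.* 3) r ⟩
      r ℕ.+ d ℕ.* 3  ≡⟨ sym p≡r+3d ⟩
      p              ∎)
  ; covers   = s≤s (begin
      p              ≡⟨ p≡r+3d ⟩
      r ℕ.+ d ℕ.* 3  ≤⟨ ℕₚ.+-monoˡ-≤ (d ℕ.* 3) r≤1 ⟩
      1 ℕ.+ d ℕ.* 3  ≡⟨ one-plus-three-d d ⟩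
      2 ℕ.* d ℕ.+ 1 ℕ.+ d ∎)
  ; at-most  = ℕₚ.≤-reflexive (double-d d)
  }
  where
  open ℕₚ.≤-Reasoning
  d = p / 3
  r = p % 3
  p≡r+3d : p ≡ r ℕ.+ d ℕ.* 3
  p≡r+3d = m≡m%n+[m/n]*n p 3
  1≤d : 1 ≤ d
  1≤d = /-monoˡ-≤ 3 3≤p
  r≤1 : r ≤ 1
  r≤1 = ℕₚ.≤-pred (ℕₚ.≤∧≢⇒< (ℕₚ.≤-pred (m%n<n p 3)) p%3≢2)
  three-d : ∀ d → 2 ℕ.* d ℕ.+ d ≡ d ℕ.* 3
  three-d = ℕ-Ring.solve-∀
  one-plus-three-d : ∀ d → 1 ℕ.+ d ℕ.* 3 ≡ 2 ℕ.* d ℕ.+ 1 ℕ.+ d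
  one-plus-three-d = ℕ-Ring.solve-∀
  double-d : ∀ d → 2 ℕ.* d ℕ.+ 1 ≡ suc (d ℕ.+ d)
  double-d = ℕ-Ring.solve-∀

bounds-above-third : ∀ p H → p / 3 < H → H ≤ p / 2 → Bounds (suc p) H (2 ℕ.* H)
bounds-above-third p H d<H H≤half = record
  { positive = ℕₚ.≤-trans (ℕₚ.≤-trans (s≤s z≤n) d<H) (ℕₚ.m≤n*m H 2)
  ; below-q  = s≤s (begin
      2 ℕ.* H        ≤⟨ ℕₚ.*-monoʳ-≤ 2 H≤half ⟩
      2 ℕ.* (p / 2)  ≡⟨ ℕₚ.*-comm 2 (p / 2) ⟩
      p / 2 ℕ.* 2    ≤⟨ m/n*n≤m p 2 ⟩
      p              ∎)
  ; covers   = s≤s (begin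
      p              ≡⟨ m≡m%n+[m/n]*n p 3 ⟩
      r ℕ.+ d ℕ.* 3  ≤⟨ ℕₚ.+-monoˡ-≤ (d ℕ.* 3) (ℕₚ.≤-pred (m%n<n p 3)) ⟩
      2 ℕ.+ d ℕ.* 3  ≤⟨ ℕₚ.n≤1+n _ ⟩
      suc d ℕ.* 3    ≤⟨ ℕₚ.*-monoˡ-≤ 3 d<H ⟩
      H ℕ.* 3        ≡⟨ three-H H ⟩
      2 ℕ.* H ℕ.+ H  ∎)
  ; at-most  = ℕₚ.≤-trans (ℕₚ.≤-reflexive (double-H H)) (ℕₚ.n≤1+n _)
  }
  where
  open ℕₚ.≤-Reasoning
  d = p / 3
  r = p % 3
  three-H : ∀ H → H ℕ.* 3 ≡ 2 ℕ.* H ℕ.+ H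
  three-H = ℕ-Ring.solve-∀
  double-H : ∀ H → 2 ℕ.* H ≡ H ℕ.+ H
  double-H = ℕ-Ring.solve-∀

bH-bounds : ∀ p H → Prime (suc p) → 3 ≤ p → p / 3 ≤ H → H ≤ p / 2 →
  Bounds (suc p) H (bH (suc p) H)
bH-bounds p H q-prime 3≤p d≤H H≤half with H ℕ.≟ p / 3
... | yes refl = bounds-at-third p (prime-mod-3 p q-prime (s≤s 3≤p)) 3≤p
... | no H≢d = bounds-above-third p H (ℕₚ.≤∧≢⇒< d≤H (λ d≡H → H≢d (sym d≡H))) H≤half

bisecant-on-ℓ₀ : ∀ q H X → Bounds q H (bH q H) → OnL0 q X → OnBisecant q H X
bisecant-on-ℓ₀ q H X bounds onℓ₀ =
  Ppt , Tpt q H , inj₁ refl , inj₂ (inj₁ refl) , P≢T q (bH q H) positive below-q ,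
  ℓ₀-collinear q X (+ bH q H) onℓ₀
  where open Bounds bounds

bisecant-via-P : ∀ q H X t → 1 < q → t < q → q ≤ t ℕ.+ H → ConicPointAt (+ q) X (+ t) →
  OnBisecant q H X
bisecant-via-P q H X t 1<q t<q q≤t+H atT =
  Ppt , vpt i , inj₁ refl , inj₂ (inj₂ (i , i≤H , refl)) , ℓ₀-avoids-vpt q (+ 0) i 1<q ,
  P-chord q X i t atT (∣-by i+t≡q ∣-refl)
  where
  i = q ∸ t
  i≤H : i ≤ H
  i≤H = ℕₚ.m≤n+o⇒m∸n≤o q t q≤t+H
  i+t≡q : + i + + t ≡ + q
  i+t≡q = trans (sym (ℤₚ.pos-+ i t)) (cong +_ (ℕₚ.m∸n+n≡m (ℕₚ.<⇒≤ t<q)))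

bisecant-via-T : ∀ q H X t → 1 < q → Bounds q H (bH q H) → H < t → t ℕ.+ H < q →
  ConicPointAt (+ q) X (+ t) → OnBisecant q H X
bisecant-via-T q H X t 1<q bounds H<t t+H<q atT =
  Tpt q H , vpt i , inj₂ (inj₁ refl) , inj₂ (inj₂ (i , i≤H , refl)) ,
  ℓ₀-avoids-vpt q (+ b) i 1<q ,
  subst (λ B → Collinear q X (+ 0 , + 1 , + B) (vpt i)) (ℕₚ.m∸n+n≡m t≤b) (T-chord q X i t atT)
  where
  open Bounds bounds
  b = bH q H
  i = b ∸ t
  t≤b : t ≤ b
  t≤b = ℕₚ.+-cancelʳ-≤ H t b (ℕₚ.≤-pred (ℕₚ.≤-trans t+H<q covers))
  i≤H : i ≤ H
  i≤H = ℕₚ.m≤n+o⇒m∸n≤o b t (ℕₚ.≤-trans at-most (ℕₚ.+-monoˡ-≤ H H<t))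

bisecant-at-residue : ∀ q H X → 1 < q → Bounds q H (bH q H) → ¬ InV q H X →
  (∃ λ t → t < q × ConicPointAt (+ q) X (+ t)) → OnBisecant q H X
bisecant-at-residue q H X 1<q bounds ∉V (t , t<q , atT) with t ≤? H
... | yes t≤H = ⊥-elim (∉V (t , t≤H , same-as-vpt q X t atT))
... | no t≰H with q ≤? t ℕ.+ H
...   | yes q≤t+H = bisecant-via-P q H X t 1<q t<q q≤t+H atT
...   | no q≰t+H = bisecant-via-T q H X t 1<q bounds (ℕₚ.≰⇒> t≰H) (ℕₚ.≰⇒> q≰t+H) atT

on-bisecant : ∀ q H → Prime q → Bounds q H (bH q H) →
  (X : Triple) → (OnL0 q X ⊎ (OnConic q X × ¬ InV q H X)) → OnBisecant q H X
on-bisecant q H q-prime bounds X (inj₁ onℓ₀) = bisecant-on-ℓ₀ q H X bounds onℓ₀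
on-bisecant q H q-prime bounds X (inj₂ (onC , ∉V)) with OnL0? q X
... | yes onℓ₀ = bisecant-on-ℓ₀ q H X bounds onℓ₀
... | no offℓ₀ = bisecant-at-residue q H X (prime>1 q-prime) bounds ∉V
                   (conic-normal-form X q-prime offℓ₀ onC)

theorem10 : (q H : ℕ) → Prime q → q % 2 ≡ 1 → 19 ≤ q →
    (q Data.Nat.∸ 1) / 3 ≤ H → H ≤ (q Data.Nat.∸ 1) / 2 →
    (X : Triple) → IsPoint q X →
    (OnL0 q X ⊎ (OnConic q X × ¬ InV q H X)) →
    OnBisecant q H X
theorem10 zero H _ _ () _ _ _ _ _
theorem10 (suc p) H q-prime _ 19≤q d≤H H≤half X _ position =
  on-bisecant (suc p) H q-prime (bH-bounds p H q-prime 3≤p d≤H H≤half) X position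
  where
  3≤p : 3 ≤ p
  3≤p = ℕₚ.≤-trans (ℕₚ.m≤m+n 3 15) (ℕₚ.≤-pred 19≤q)
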